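{- Let $G$ be an autonomous OSP-graph and let $x$ be a positive integer larger than every vertex of $G$. Then $G\oplus x$ is autonomous.
   Context: A simple pseudo-graph is a finite graph that may have loops but no multiple edges; its edge set $E(G)\subseteq V(G)\times V(G)$ is a symmetric relation, and $v$ is looped iff $vv\in E(G)$. Write $N(v)=\{w: vw\in E(G)\}$ and $\mathcal{L}(G)$ for the set of looped vertices. An OSP-graph is a simple pseudo-graph whose vertex set is a finite set of positive integers with the usual order. Pressing a looped vertex $v$ produces $G_{(v)}$ with vertex set $V(G)$ and edge set $E(G)\,\triangle\,(N(v)\times N(v))$; $G_{(v_1,\dots,v_k)}$ denotes successive pressing. A successful pressing sequence is a sequence $(v_1,\dots,v_k)$ with each $v_i$ looped in $G_{(v_1,\dots,v_{i-1})}$ and $G_{(v_1,\dots,v_k)}$ having no edges and no loops; $\Sigma(G)$ is their set. $G$ is full-rank if its adjacency matrix (diagonal entry $1$ at looped vertices) is invertible over $\mathbb{F}_2$. For full-rank $G$ on $n$ vertices and $\sigma=(v_1,\dots,v_n)\in\Sigma(G)$, let $U$ be the upper-triangular $0/1$ matrix with $U[i,j]=1$ iff $i\le j$ and $v_iv_j\in E(G_{(v_1,\dots,v_{i-1})})$, $D$ the digraph on $V(G)$ with arc $v_i\to v_j$ whenever $U[i,j]=1$, and $\mathcal{P}(G,\sigma)=(V(G),\preceq)$ the poset with $y\preceq x$ iff there is a directed path (possibly of length $0$) from $x$ to $y$ in $D$. $\mathcal{P}(G)$ denotes $\mathcal{P}(G,\sigma)$ for $\sigma$ the increasing order of $V(G)$.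 A linear extension of a poset is a listing $(\tau_1,\dots,\tau_n)$ of its elements with $\tau_i\succ\tau_j\Rightarrow i<j$; $\mathrm{LinExt}(\mathcal{P})$ is their set. A full-rank OSP-graph $G$ is autonomous if the increasing order of $V(G)$ belongs to $\Sigma(G)$ and $\Sigma(G)=\mathrm{LinExt}(\mathcal{P}(G))$. For $x\notin V(G)$, $G\oplus x$ is the OSP-graph with vertex set $V(G)\cup\{x\}$, edge set $E(G)\cup\{lx, xl : l\in\mathcal{L}(G)\}$, with additionally a loop at $x$ if and only if $|V(G)|$ is even (so $\mathcal{L}(G\oplus x)=\mathcal{L}(G)$ if $|V(G)|$ is odd and $\mathcal{L}(G)\cup\{x\}$ if $|V(G)|$ is even). -}

module Defs where

open import Data.Bool using (Bool; true; false; _∧_; _∨_; _xor_; if_then_else_)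
open import Data.Nat using (ℕ; zero; suc; _<_; _≤_; _<ᵇ_; _≡ᵇ_)
open import Data.Nat.Properties using ()
open import Data.Fin as Fin using (Fin; toℕ)
open import Data.List using (List; []; _∷_; length; lookup; take)
open import Data.List.Relation.Unary.All using (All)
open import Data.List.Relation.Unary.Linked using (Linked)
open import Data.List.Membership.Propositional using (_∈_)
open import Data.List.Relation.Binary.Permutation.Propositional using (_↭_)
open import Data.Product using (Σ; _×_; ∃; ∃-syntax)
open import Relation.Binary.PropositionalEquality using (_≡_; _≢_)

-- V : the vertex set, stored as its strictly increasing listing
--     (so V itself is "the increasing order of V(G)").
-- E : the edge relation as a Boolean-valued function; u is looped iff E u u.

record SPG : Set where
  constructor mkSPG
  field
    V : List ℕ
    E : ℕ → ℕ → Bool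
open SPG public

-- G is an OSP-graph (in canonical representation): vertex list strictly
-- increasing (hence a finite set of positive integers with its usual order),
-- all vertices positive, E symmetric and supported on V.
record IsOSP (G : SPG) : Set where
  field
    increasing : Linked _<_ (V G)
    positive   : All (λ v → 0 < v) (V G)
    symmetric  : ∀ u w → E G u w ≡ E G w u
    supported  : ∀ u w → E G u w ≡ true → u ∈ V G × w ∈ V G

press : SPG → ℕ → SPG
press G v = mkSPG (V G) (λ a b → E G a b xor (E G v a ∧ E G v b))

pressSeq : SPG → List ℕ → SPG
pressSeq G []       = G
pressSeq G (v ∷ vs) = pressSeq (press G v) vs

Successful : SPG → List ℕ → Set
Successful G []       = ∀ a b → E G a b ≡ false
Successful G (v ∷ vs) = E G v v ≡ true × Successful (press G v) vs

-- Full rank: adjacency matrix (indexed by positions in V) invertible over 𝔽₂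

Mat : ℕ → Set
Mat n = Fin n → Fin n → Bool

xorSum : ∀ n → (Fin n → Bool) → Bool
xorSum zero    f = false
xorSum (suc n) f = f Fin.zero xor xorSum n (λ i → f (Fin.suc i))

_⊗_ : ∀ {n} → Mat n → Mat n → Mat n
_⊗_ {n} A B i k = xorSum n (λ j → A i j ∧ B j k)

identity : ∀ {n} → Mat n
identity i j = toℕ i ≡ᵇ toℕ j

adjacency : (G : SPG) → Mat (length (V G))
adjacency G i j = E G (lookup (V G) i) (lookup (V G) j)

FullRank : SPG → Set
FullRank G = Σ (Mat (length (V G))) λ B →
  (∀ i j → (adjacency G ⊗ B) i j ≡ identity i j) ×
  (∀ i j → (B ⊗ adjacency G) i j ≡ identity i j)

-- The poset 𝒫(G) = 𝒫(G, σ) for σ the increasing order V G.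

Arc : SPG → ℕ → ℕ → Set
Arc G x y = Σ (Fin (length (V G))) λ i → Σ (Fin (length (V G))) λ j →
  toℕ i ≤ toℕ j × lookup (V G) i ≡ x × lookup (V G) j ≡ y ×
  E (pressSeq G (take (toℕ i) (V G))) x y ≡ true

-- Path G x y : a directed path (possibly of length 0) from x to y in D,
-- i.e. y ⪯ x in 𝒫(G).
data Path (G : SPG) : ℕ → ℕ → Set where
  here  : ∀ {x} → Path G x x
  there : ∀ {x y z} → Arc G x y → Path G y z → Path G x z

_≼[_]_ : ℕ → SPG → ℕ → Set
y ≼[ G ] x = Path G x y

_≻[_]_ : ℕ → SPG → ℕ → Set
x ≻[ G ] y = (y ≼[ G ] x) × x ≢ y

LinExt : SPG → List ℕ → Set
LinExt G τ = (τ ↭ V G) ×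
  (∀ (i j : Fin (length τ)) → lookup τ i ≻[ G ] lookup τ j → i Fin.< j)

Autonomous : SPG → Set
Autonomous G = FullRank G × Successful G (V G) ×
  (∀ τ → (Successful G τ → LinExt G τ) × (LinExt G τ → Successful G τ))

insert : ℕ → List ℕ → List ℕ
insert x []       = x ∷ []
insert x (y ∷ ys) = if x <ᵇ y then x ∷ y ∷ ys else y ∷ insert x ys

even? : ℕ → Bool
even? zero          = true
even? (suc zero)    = false
even? (suc (suc n)) = even? n

-- (for x ∉ V(G); then E G x _ = false by support)
_⊕_ : SPG → ℕ → SPG
G ⊕ x = mkSPG (insert x (V G)) E′
  where
  E′ : ℕ → ℕ → Bool
  E′ u w = E G u w
         ∨ ((u ≡ᵇ x) ∧ E G w w)
         ∨ ((w ≡ᵇ x) ∧ E G u u)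
         ∨ ((u ≡ᵇ x) ∧ (w ≡ᵇ x) ∧ even? (length (V G)))

-- In G ⊕ x the new vertex is adjacent exactly to the looped vertices, so G ⊕ x is a cone over G
-- whose apex loop records the parity of |V G|. Pressing a looped vertex v ≠ x turns the cone over K
-- into the cone over K_(v) and toggles the apex loop, so the apex is looped exactly when an even
-- number of vertices of G remain to be pressed (all successful sequences of G have length |V G|).
-- Pressing the apex replaces K by the loopless graph K + l lᵀ (l the loop vector of K), after which
-- nothing can be pressed; parity then forces K to be empty. Hence Σ(G ⊕ x) = {τ x : τ ∈ Σ(G)}.
-- In 𝒫(G ⊕ x) every vertex of G lies above x (it is looped, hence adjacent to x, when pressed)
-- and the order on V G is that of 𝒫(G), so the linear extensions are the same lists τ x.
-- For full rank, the adjacency matrix of G ⊕ x is A bordered by its diagonal l; with B = A⁻¹ and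
-- u = B l its inverse is [[B + u uᵀ, u], [uᵀ, 1]], because lᵀ B l = tr (A B) = |V G| mod 2.

module Submission where

open import Defs
open import Data.Nat using (ℕ; _<_)
open import Data.List.Relation.Unary.All using (All)

open import Algebra.Bundles using (CommutativeRing)
open import Data.Bool using (Bool; true; false; not; T; _∧_; _xor_; _≟_; if_then_else_)
open import Data.Bool.Properties
  using (xor-assoc; xor-comm; xor-same; xor-identityʳ; not-involutive; ∧-comm; ∧-assoc; ∧-idem;
         ∧-identityʳ; ∧-zeroʳ; ∧-distribˡ-xor; ∨-identityʳ; xor-∧-commutativeRing)
open import Data.Empty using (⊥-elim)
open import Data.Fin as Fin using (Fin; toℕ; inject₁; fromℕ; cast)
open import Data.Fin.Properties using (toℕ-inject₁; cast-is-id)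
open import Data.List using (List; []; _∷_; _++_; _∷ʳ_; [_]; length; lookup; take)
open import Data.List.Properties using (length-++; ++-identityʳ)
open import Data.List.Membership.Propositional using (_∈_; _∉_; lose)
open import Data.List.Membership.Propositional.Properties using (∈-++⁻; ∈-++⁺ʳ; ∈-lookup)
open import Data.List.Relation.Binary.Permutation.Propositional using (_↭_; ↭-sym)
open import Data.List.Relation.Binary.Permutation.Propositional.Properties
  using (↭-length; ∈-resp-↭; ++⁺ʳ; drop-mid)
open import Data.List.Relation.Unary.All as All using ([]; _∷_)
open import Data.List.Relation.Unary.Any using (here; there; any?; satisfied)
open import Data.List.Reverse using (reverseView; []; _∶_∶ʳ_)
open import Data.Maybe as Maybe using (Maybe; just; nothing; maybe)
open import Data.Nat as ℕ using (zero; suc; _≤_; z≤n; s≤s; _<ᵇ_; _≡ᵇ_)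
open import Data.Nat.Properties
  using (+-comm; ≤-<-trans; <⇒≤; <-irrefl; <-asym; ≤-pred; <-≤-trans; <ᵇ⇒<)
open import Data.Product using (Σ; ∃; _×_; _,_; proj₁; proj₂)
open import Data.Sum using (_⊎_; inj₁; inj₂)
open import Data.Unit using (⊤; tt)
open import Function using (_∘_)
open import Relation.Binary.PropositionalEquality
  using (_≡_; _≢_; refl; sym; trans; cong; cong₂; subst; subst₂; module ≡-Reasoning)
open import Relation.Nullary using (yes; no)
open import Relation.Nullary.Decidable using (dec-true; dec-false)
open import Algebra.Properties.CommutativeSemigroup
  (CommutativeRing.+-commutativeSemigroup xor-∧-commutativeRing) using (interchange)

-- Sums and matrices over 𝔽₂

even?-suc : ∀ n → even? (suc n) ≡ not (even? n)
even?-suc zero          = refl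
even?-suc (suc zero)    = refl
even?-suc (suc (suc n)) = even?-suc n

xor-cancelʳ : ∀ a b → (a xor b) xor b ≡ a
xor-cancelʳ a b = trans (xor-assoc a b b) (trans (cong (a xor_) (xor-same b)) (xor-identityʳ a))

xor≡false⇒≡ : ∀ {p q} → p xor q ≡ false → p ≡ q
xor≡false⇒≡ {true}  {true}  _ = refl
xor≡false⇒≡ {false} {false} _ = refl

identity-refl : ∀ {n} (i : Fin n) → identity i i ≡ true
identity-refl Fin.zero    = refl
identity-refl (Fin.suc i) = identity-refl i

identity-sym : ∀ {n} (i j : Fin n) → identity i j ≡ identity j i
identity-sym Fin.zero    Fin.zero    = refl
identity-sym Fin.zero    (Fin.suc j) = refl
identity-sym (Fin.suc i) Fin.zero    = refl
identity-sym (Fin.suc i) (Fin.suc j) = identity-sym i j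

xorSum-cong : ∀ n {f g : Fin n → Bool} → (∀ i → f i ≡ g i) → xorSum n f ≡ xorSum n g
xorSum-cong zero    f≗g = refl
xorSum-cong (suc n) f≗g = cong₂ _xor_ (f≗g Fin.zero) (xorSum-cong n (f≗g ∘ Fin.suc))

xorSum-false : ∀ n → xorSum n (λ _ → false) ≡ false
xorSum-false zero    = refl
xorSum-false (suc n) = xorSum-false n

xorSum-true : ∀ n → xorSum n (λ _ → true) ≡ not (even? n)
xorSum-true zero    = refl
xorSum-true (suc n) = cong not (trans (xorSum-true n) (sym (even?-suc n)))

xorSum-xor : ∀ n (f g : Fin n → Bool) →
             xorSum n (λ i → f i xor g i) ≡ xorSum n f xor xorSum n g
xorSum-xor zero    f g = refl
xorSum-xor (suc n) f g =
  trans (cong ((f Fin.zero xor g Fin.zero) xor_) (xorSum-xor n (f ∘ Fin.suc) (g ∘ Fin.suc)))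
        (interchange (f Fin.zero) (g Fin.zero) _ _)

xorSum-∧ˡ : ∀ n c (f : Fin n → Bool) → xorSum n (λ i → c ∧ f i) ≡ c ∧ xorSum n f
xorSum-∧ˡ zero    c f = sym (∧-comm c false)
xorSum-∧ˡ (suc n) c f =
  trans (cong ((c ∧ f Fin.zero) xor_) (xorSum-∧ˡ n c (f ∘ Fin.suc)))
        (sym (∧-distribˡ-xor c _ _))

xorSum-∧ʳ : ∀ n c (f : Fin n → Bool) → xorSum n (λ i → f i ∧ c) ≡ xorSum n f ∧ c
xorSum-∧ʳ n c f =
  trans (xorSum-cong n (λ i → ∧-comm (f i) c)) (trans (xorSum-∧ˡ n c f) (∧-comm c _))

xorSum-swap : ∀ m n (f : Fin m → Fin n → Bool) →
              xorSum m (λ i → xorSum n (f i)) ≡ xorSum n (λ j → xorSum m (λ i → f i j))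
xorSum-swap zero    n f = sym (xorSum-false n)
xorSum-swap (suc m) n f =
  trans (cong (xorSum n (f Fin.zero) xor_) (xorSum-swap m n (f ∘ Fin.suc)))
        (sym (xorSum-xor n (f Fin.zero) (λ j → xorSum m (λ i → f (Fin.suc i) j))))

xorSum-identityˡ : ∀ n (f : Fin n → Bool) j → xorSum n (λ k → identity j k ∧ f k) ≡ f j
xorSum-identityˡ (suc n) f Fin.zero    =
  trans (cong (f Fin.zero xor_) (xorSum-false n)) (xor-identityʳ _)
xorSum-identityˡ (suc n) f (Fin.suc j) = xorSum-identityˡ n (f ∘ Fin.suc) j

xorSum-identityʳ : ∀ n (f : Fin n → Bool) j → xorSum n (λ k → f k ∧ identity k j) ≡ f j
xorSum-identityʳ n f j = trans
  (xorSum-cong n (λ k → trans (∧-comm (f k) _) (cong (_∧ f k) (identity-sym k j))))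
  (xorSum-identityˡ n f j)

xorSum-last : ∀ n (f : Fin (suc n) → Bool) →
              xorSum (suc n) f ≡ xorSum n (f ∘ inject₁) xor f (fromℕ n)
xorSum-last zero    f = xor-comm (f Fin.zero) false
xorSum-last (suc n) f =
  trans (cong (f Fin.zero xor_) (xorSum-last n (f ∘ Fin.suc))) (sym (xor-assoc (f Fin.zero) _ _))

Symmetric : ∀ {n} → Mat n → Set
Symmetric A = ∀ i j → A i j ≡ A j i

-- Over 𝔽₂ the off-diagonal terms of a symmetric matrix cancel in pairs.
xorSum-symmetric : ∀ n (M : Mat n) → Symmetric M →
                   xorSum n (λ i → xorSum n (M i)) ≡ xorSum n (λ i → M i i)
xorSum-symmetric zero    M M-sym = refl
xorSum-symmetric (suc n) M M-sym = begin
  (M₀₀ xor row) xor xorSum n (λ i → M (Fin.suc i) Fin.zero xor xorSum n (M′ i))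
    ≡⟨ cong ((M₀₀ xor row) xor_)
            (xorSum-xor n (λ i → M (Fin.suc i) Fin.zero) (λ i → xorSum n (M′ i))) ⟩
  (M₀₀ xor row) xor (col xor xorSum n (λ i → xorSum n (M′ i)))
    ≡⟨ cong (λ r → (M₀₀ xor r) xor (col xor xorSum n (λ i → xorSum n (M′ i))))
            (xorSum-cong n (λ j → M-sym Fin.zero (Fin.suc j))) ⟩
  (M₀₀ xor col) xor (col xor xorSum n (λ i → xorSum n (M′ i)))
    ≡⟨ cancel M₀₀ col _ ⟩
  M₀₀ xor xorSum n (λ i → xorSum n (M′ i))
    ≡⟨ cong (M₀₀ xor_) (xorSum-symmetric n M′ (λ i j → M-sym (Fin.suc i) (Fin.suc j))) ⟩
  M₀₀ xor xorSum n (λ i → M′ i i) ∎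
  where
  open ≡-Reasoning
  M₀₀ = M Fin.zero Fin.zero
  row = xorSum n (λ j → M Fin.zero (Fin.suc j))
  col = xorSum n (λ i → M (Fin.suc i) Fin.zero)
  M′ : Mat n
  M′ i j = M (Fin.suc i) (Fin.suc j)
  cancel : ∀ a s d → (a xor s) xor (s xor d) ≡ a xor d
  cancel a s d = begin
    (a xor s) xor (s xor d) ≡⟨ xor-assoc a s (s xor d) ⟩
    a xor (s xor (s xor d)) ≡⟨ cong (a xor_) (sym (xor-assoc s s d)) ⟩
    a xor ((s xor s) xor d) ≡⟨ cong (λ z → a xor (z xor d)) (xor-same s) ⟩
    a xor d                 ∎

infix 7 _·_

_·_ : ∀ {n} → (Fin n → Bool) → (Fin n → Bool) → Bool
_·_ {n} r s = xorSum n (λ j → r j ∧ s j)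

column : ∀ {n} → Mat n → Fin n → Fin n → Bool
column B k j = B j k

diagonal : ∀ {n} → Mat n → Fin n → Bool
diagonal A i = A i i

·-xor-∧ : ∀ {n} (r s t : Fin n → Bool) w →
          r · (λ j → s j xor (t j ∧ w)) ≡ r · s xor (r · t ∧ w)
·-xor-∧ {n} r s t w = begin
  r · (λ j → s j xor (t j ∧ w))
    ≡⟨ xorSum-cong n (λ j → ∧-distribˡ-xor (r j) (s j) (t j ∧ w)) ⟩
  xorSum n (λ j → (r j ∧ s j) xor (r j ∧ (t j ∧ w)))
    ≡⟨ xorSum-xor n _ _ ⟩
  r · s xor xorSum n (λ j → r j ∧ (t j ∧ w))
    ≡⟨ cong (r · s xor_) (trans (xorSum-cong n (λ j → sym (∧-assoc (r j) (t j) w)))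
                                (xorSum-∧ʳ n w (λ j → r j ∧ t j))) ⟩
  r · s xor (r · t ∧ w) ∎
  where open ≡-Reasoning

Invertible : ∀ {n} → Mat n → Set
Invertible {n} A = Σ (Mat n) λ B →
  (∀ i j → (A ⊗ B) i j ≡ identity i j) × (∀ i j → (B ⊗ A) i j ≡ identity i j)

invertible-cong : ∀ {n} {M C : Mat n} → (∀ i j → M i j ≡ C i j) → Invertible C → Invertible M
invertible-cong {n} M≗C (D , CD , DC) =
    D
  , (λ i j → trans (xorSum-cong n (λ k → cong (_∧ D k j) (M≗C i k))) (CD i j))
  , (λ i j → trans (xorSum-cong n (λ k → cong (D i k ∧_) (M≗C k j))) (DC i j))

invertible-cast : ∀ {m n} (eq : m ≡ n) {M : Mat m} {C : Mat n} →
                  (∀ i j → M i j ≡ C (cast eq i) (cast eq j)) → Invertible C → Invertible M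
invertible-cast refl {C = C} M≗C = invertible-cong λ i j →
  trans (M≗C i j) (cong₂ C (cast-is-id refl i) (cast-is-id refl j))

⊗-assoc : ∀ {n} (X Y Z : Mat n) i l → ((X ⊗ Y) ⊗ Z) i l ≡ (X ⊗ (Y ⊗ Z)) i l
⊗-assoc {n} X Y Z i l = begin
  xorSum n (λ k → xorSum n (λ j → X i j ∧ Y j k) ∧ Z k l)
    ≡⟨ xorSum-cong n (λ k → sym (xorSum-∧ʳ n (Z k l) (λ j → X i j ∧ Y j k))) ⟩
  xorSum n (λ k → xorSum n (λ j → (X i j ∧ Y j k) ∧ Z k l))
    ≡⟨ xorSum-swap n n (λ k j → (X i j ∧ Y j k) ∧ Z k l) ⟩
  xorSum n (λ j → xorSum n (λ k → (X i j ∧ Y j k) ∧ Z k l))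
    ≡⟨ xorSum-cong n (λ j → trans (xorSum-cong n (λ k → ∧-assoc (X i j) (Y j k) (Z k l)))
                                  (xorSum-∧ˡ n (X i j) (λ k → Y j k ∧ Z k l))) ⟩
  xorSum n (λ j → X i j ∧ xorSum n (λ k → Y j k ∧ Z k l)) ∎
  where open ≡-Reasoning

⊗-transpose : ∀ {n} {A B : Mat n} → Symmetric A → Symmetric B →
              ∀ i k → (A ⊗ B) i k ≡ (B ⊗ A) k i
⊗-transpose {n} {A} {B} A-sym B-sym i k =
  xorSum-cong n λ j → trans (∧-comm (A i j) (B j k)) (cong₂ _∧_ (B-sym j k) (A-sym i j))

left-inverse-symmetric : ∀ {n} {A B : Mat n} → Symmetric A →
                         (∀ i j → (B ⊗ A) i j ≡ identity i j) → Symmetric B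
left-inverse-symmetric {n} {A} {B} A-sym BA i j = begin
  B i j                             ≡⟨ sym (xorSum-identityʳ n (B i) j) ⟩
  xorSum n (λ k → B i k ∧ identity k j) ≡⟨ xorSum-cong n (λ k → cong (B i k ∧_) (sym (ABᵀ k))) ⟩
  (B ⊗ (A ⊗ Bᵀ)) i j                ≡⟨ sym (⊗-assoc B A Bᵀ i j) ⟩
  ((B ⊗ A) ⊗ Bᵀ) i j                ≡⟨ xorSum-cong n (λ m → cong (_∧ B j m) (BA i m)) ⟩
  xorSum n (λ m → identity i m ∧ B j m) ≡⟨ xorSum-identityˡ n (B j) i ⟩
  B j i                             ∎
  where
  open ≡-Reasoning
  Bᵀ : Mat n
  Bᵀ a b = B b a
  ABᵀ : ∀ k → (A ⊗ Bᵀ) k j ≡ identity k j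
  ABᵀ k = trans (xorSum-cong n (λ m → trans (∧-comm (A k m) (B j m)) (cong (B j m ∧_) (A-sym k m))))
                (trans (BA j k) (identity-sym j k))

unlast : ∀ {n} → Fin (suc n) → Maybe (Fin n)
unlast {zero}  Fin.zero    = nothing
unlast {suc n} Fin.zero    = just Fin.zero
unlast {suc n} (Fin.suc i) = Maybe.map Fin.suc (unlast i)

unlast-inject₁ : ∀ {n} (a : Fin n) → unlast (inject₁ a) ≡ just a
unlast-inject₁ Fin.zero    = refl
unlast-inject₁ (Fin.suc a) = cong (Maybe.map Fin.suc) (unlast-inject₁ a)

unlast-fromℕ : ∀ n → unlast (fromℕ n) ≡ nothing
unlast-fromℕ zero    = refl
unlast-fromℕ (suc n) = cong (Maybe.map Fin.suc) (unlast-fromℕ n)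

data LastView {n : ℕ} : Fin (suc n) → Set where
  inject : (a : Fin n) → LastView (inject₁ a)
  last   : LastView (fromℕ n)

lastView : ∀ {n} (i : Fin (suc n)) → LastView i
lastView {zero}  Fin.zero    = last
lastView {suc n} Fin.zero    = inject Fin.zero
lastView {suc n} (Fin.suc i) with lastView i
... | inject a = inject (Fin.suc a)
... | last     = last

borderEntry : ∀ {n} → Mat n → (Fin n → Bool) → Bool → Maybe (Fin n) → Maybe (Fin n) → Bool
borderEntry A r c (just a) (just b) = A a b
borderEntry A r c (just a) nothing  = r a
borderEntry A r c nothing  (just b) = r b
borderEntry A r c nothing  nothing  = c

-- The symmetric bordering [[A, r], [rᵀ, c]].
border : ∀ {n} → Mat n → (Fin n → Bool) → Bool → Mat (suc n)
border A r c i j = borderEntry A r c (unlast i) (unlast j)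

module _ {n} (A : Mat n) (r : Fin n → Bool) (c : Bool) where

  border-inject : ∀ a b → border A r c (inject₁ a) (inject₁ b) ≡ A a b
  border-inject a b rewrite unlast-inject₁ a | unlast-inject₁ b = refl

  border-inject-last : ∀ a → border A r c (inject₁ a) (fromℕ n) ≡ r a
  border-inject-last a rewrite unlast-inject₁ a | unlast-fromℕ n = refl

  border-last-inject : ∀ b → border A r c (fromℕ n) (inject₁ b) ≡ r b
  border-last-inject b rewrite unlast-inject₁ b | unlast-fromℕ n = refl

  border-last : border A r c (fromℕ n) (fromℕ n) ≡ c
  border-last rewrite unlast-fromℕ n = refl

  border-symmetric : Symmetric A → Symmetric (border A r c)
  border-symmetric A-sym i j with unlast i | unlast j
  ... | just a  | just b  = A-sym a b
  ... | just a  | nothing = refl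
  ... | nothing | just b  = refl
  ... | nothing | nothing = refl

module _ {n} (A : Mat n) (r : Fin n → Bool) (c : Bool)
             (A′ : Mat n) (r′ : Fin n → Bool) (c′ : Bool) where

  private
    C = border A r c
    C′ = border A′ r′ c′

  ⊗-border-inject : ∀ a b → (C ⊗ C′) (inject₁ a) (inject₁ b) ≡ (A ⊗ A′) a b xor (r a ∧ r′ b)
  ⊗-border-inject a b =
    trans (xorSum-last n (λ j → C (inject₁ a) j ∧ C′ j (inject₁ b))) (cong₂ _xor_
    (xorSum-cong n (λ j → cong₂ _∧_ (border-inject A r c a j) (border-inject A′ r′ c′ j b)))
    (cong₂ _∧_ (border-inject-last A r c a) (border-last-inject A′ r′ c′ b)))

  ⊗-border-inject-last : ∀ a → (C ⊗ C′) (inject₁ a) (fromℕ n) ≡ A a · r′ xor (r a ∧ c′)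
  ⊗-border-inject-last a =
    trans (xorSum-last n (λ j → C (inject₁ a) j ∧ C′ j (fromℕ n))) (cong₂ _xor_
    (xorSum-cong n (λ j → cong₂ _∧_ (border-inject A r c a j) (border-inject-last A′ r′ c′ j)))
    (cong₂ _∧_ (border-inject-last A r c a) (border-last A′ r′ c′)))

  ⊗-border-last-inject : ∀ b → (C ⊗ C′) (fromℕ n) (inject₁ b) ≡ r · column A′ b xor (c ∧ r′ b)
  ⊗-border-last-inject b =
    trans (xorSum-last n (λ j → C (fromℕ n) j ∧ C′ j (inject₁ b))) (cong₂ _xor_
    (xorSum-cong n (λ j → cong₂ _∧_ (border-last-inject A r c j) (border-inject A′ r′ c′ j b)))
    (cong₂ _∧_ (border-last A r c) (border-last-inject A′ r′ c′ b)))

  ⊗-border-last : (C ⊗ C′) (fromℕ n) (fromℕ n) ≡ r · r′ xor (c ∧ c′)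
  ⊗-border-last = trans (xorSum-last n (λ j → C (fromℕ n) j ∧ C′ j (fromℕ n))) (cong₂ _xor_
    (xorSum-cong n (λ j → cong₂ _∧_ (border-last-inject A r c j) (border-inject-last A′ r′ c′ j)))
    (cong₂ _∧_ (border-last A r c) (border-last A′ r′ c′)))

identity-inject₁ : ∀ {n} (a b : Fin n) → identity (inject₁ a) (inject₁ b) ≡ identity a b
identity-inject₁ a b = cong₂ _≡ᵇ_ (toℕ-inject₁ a) (toℕ-inject₁ b)

identity-inject₁-fromℕ : ∀ {n} (a : Fin n) → identity (inject₁ a) (fromℕ n) ≡ false
identity-inject₁-fromℕ Fin.zero    = refl
identity-inject₁-fromℕ (Fin.suc a) = identity-inject₁-fromℕ a

module BorderInverse {n} {A B : Mat n} (A-sym : Symmetric A)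
  (AB : ∀ i j → (A ⊗ B) i j ≡ identity i j) (BA : ∀ i j → (B ⊗ A) i j ≡ identity i j) where

  open ≡-Reasoning

  l u : Fin n → Bool
  l = diagonal A
  u i = B i · l

  B-sym : Symmetric B
  B-sym = left-inverse-symmetric A-sym BA

  A·u : ∀ a → A a · u ≡ l a
  A·u a = begin
    (A ⊗ (B ⊗ L)) a a ≡⟨ sym (⊗-assoc A B L a a) ⟩
    ((A ⊗ B) ⊗ L) a a ≡⟨ xorSum-cong n (λ m → cong (_∧ l m) (AB a m)) ⟩
    xorSum n (λ m → identity a m ∧ l m) ≡⟨ xorSum-identityˡ n l a ⟩
    l a               ∎
    where
    L : Mat n
    L i _ = l i

  l·column : ∀ b → l · column B b ≡ u b
  l·column b = xorSum-cong n λ j → trans (∧-comm (l j) (B j b)) (cong (_∧ l j) (B-sym j b))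

  -- lᵀ B l = Σ A_ii B_ii = tr (A B) = tr I.
  l·u : l · u ≡ not (even? n)
  l·u = begin
    xorSum n (λ i → l i ∧ u i)
      ≡⟨ xorSum-cong n (λ i → sym (xorSum-∧ˡ n (l i) (λ j → B i j ∧ l j))) ⟩
    xorSum n (λ i → xorSum n (λ j → l i ∧ (B i j ∧ l j)))
      ≡⟨ xorSum-symmetric n _ (λ i j → lBl-sym (l i) (B i j) (l j) (B j i) (B-sym i j)) ⟩
    xorSum n (λ i → l i ∧ (B i i ∧ l i))
      ≡⟨ xorSum-cong n (λ i → idem (l i) (B i i)) ⟩
    xorSum n (λ i → A i i ∧ B i i)
      ≡⟨ sym (xorSum-symmetric n (λ i j → A i j ∧ B j i)
                (λ i j → cong₂ _∧_ (A-sym i j) (B-sym j i))) ⟩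
    xorSum n (λ i → (A ⊗ B) i i)
      ≡⟨ xorSum-cong n (λ i → trans (AB i i) (identity-refl i)) ⟩
    xorSum n (λ _ → true)
      ≡⟨ xorSum-true n ⟩
    not (even? n) ∎
    where
    lBl-sym : ∀ a b c b′ → b ≡ b′ → a ∧ (b ∧ c) ≡ c ∧ (b′ ∧ a)
    lBl-sym true  b true  .b refl = refl
    lBl-sym true  b false .b refl = ∧-comm b false
    lBl-sym false b true  .b refl = sym (∧-comm b false)
    lBl-sym false b false .b refl = refl
    idem : ∀ a b → a ∧ (b ∧ a) ≡ a ∧ b
    idem true  b = ∧-identityʳ b
    idem false b = refl

  B′ : Mat n
  B′ a b = B a b xor (u a ∧ u b)

  C D : Mat (suc n)
  C = border A l (even? n)
  D = border B′ u true

  C⊗D-inject : ∀ a b → (C ⊗ D) (inject₁ a) (inject₁ b) ≡ identity (inject₁ a) (inject₁ b)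
  C⊗D-inject a b = begin
    (C ⊗ D) (inject₁ a) (inject₁ b)
      ≡⟨ ⊗-border-inject A l (even? n) B′ u true a b ⟩
    A a · column B′ b xor (l a ∧ u b)
      ≡⟨ cong (_xor (l a ∧ u b)) (·-xor-∧ (A a) (column B b) u (u b)) ⟩
    ((A ⊗ B) a b xor (A a · u ∧ u b)) xor (l a ∧ u b)
      ≡⟨ cong (λ z → ((A ⊗ B) a b xor (z ∧ u b)) xor (l a ∧ u b)) (A·u a) ⟩
    ((A ⊗ B) a b xor (l a ∧ u b)) xor (l a ∧ u b)
      ≡⟨ xor-cancelʳ ((A ⊗ B) a b) (l a ∧ u b) ⟩
    (A ⊗ B) a b
      ≡⟨ trans (AB a b) (sym (identity-inject₁ a b)) ⟩
    identity (inject₁ a) (inject₁ b) ∎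

  C⊗D-inject-last : ∀ a → (C ⊗ D) (inject₁ a) (fromℕ n) ≡ identity (inject₁ a) (fromℕ n)
  C⊗D-inject-last a = begin
    (C ⊗ D) (inject₁ a) (fromℕ n) ≡⟨ ⊗-border-inject-last A l (even? n) B′ u true a ⟩
    A a · u xor (l a ∧ true)      ≡⟨ cong₂ _xor_ (A·u a) (∧-identityʳ (l a)) ⟩
    l a xor l a                   ≡⟨ xor-same (l a) ⟩
    false                         ≡⟨ sym (identity-inject₁-fromℕ a) ⟩
    identity (inject₁ a) (fromℕ n) ∎

  C⊗D-last-inject : ∀ b → (C ⊗ D) (fromℕ n) (inject₁ b) ≡ identity (fromℕ n) (inject₁ b)
  C⊗D-last-inject b = begin
    (C ⊗ D) (fromℕ n) (inject₁ b)
      ≡⟨ ⊗-border-last-inject A l (even? n) B′ u true b ⟩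
    l · column B′ b xor (even? n ∧ u b)
      ≡⟨ cong (_xor (even? n ∧ u b)) (·-xor-∧ l (column B b) u (u b)) ⟩
    (l · column B b xor (l · u ∧ u b)) xor (even? n ∧ u b)
      ≡⟨ cong₂ (λ y z → (y xor (z ∧ u b)) xor (even? n ∧ u b)) (l·column b) l·u ⟩
    (u b xor (not (even? n) ∧ u b)) xor (even? n ∧ u b)
      ≡⟨ cancel (even? n) (u b) ⟩
    false
      ≡⟨ sym (trans (identity-sym (fromℕ n) (inject₁ b)) (identity-inject₁-fromℕ b)) ⟩
    identity (fromℕ n) (inject₁ b) ∎
    where
    cancel : ∀ e w → (w xor (not e ∧ w)) xor (e ∧ w) ≡ false
    cancel true  true  = refl
    cancel true  false = refl
    cancel false true  = refl
    cancel false false = refl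

  C⊗D-last : (C ⊗ D) (fromℕ n) (fromℕ n) ≡ identity (fromℕ n) (fromℕ n)
  C⊗D-last = begin
    (C ⊗ D) (fromℕ n) (fromℕ n) ≡⟨ ⊗-border-last A l (even? n) B′ u true ⟩
    l · u xor (even? n ∧ true)  ≡⟨ cong₂ _xor_ l·u (∧-identityʳ (even? n)) ⟩
    not (even? n) xor even? n   ≡⟨ not-xor (even? n) ⟩
    true                        ≡⟨ sym (identity-refl (fromℕ n)) ⟩
    identity (fromℕ n) (fromℕ n) ∎
    where
    not-xor : ∀ e → not e xor e ≡ true
    not-xor true  = refl
    not-xor false = refl

  C⊗D : ∀ i k → (C ⊗ D) i k ≡ identity i k
  C⊗D i k with lastView i | lastView k
  ... | inject a | inject b = C⊗D-inject a b
  ... | inject a | last     = C⊗D-inject-last a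
  ... | last     | inject b = C⊗D-last-inject b
  ... | last     | last     = C⊗D-last

  D⊗C : ∀ i k → (D ⊗ C) i k ≡ identity i k
  D⊗C i k = begin
    (D ⊗ C) i k ≡⟨ ⊗-transpose D-sym C-sym i k ⟩
    (C ⊗ D) k i ≡⟨ C⊗D k i ⟩
    identity k i ≡⟨ identity-sym k i ⟩
    identity i k ∎
    where
    C-sym = border-symmetric A l (even? n) A-sym
    D-sym = border-symmetric B′ u true (λ a b → cong₂ _xor_ (B-sym a b) (∧-comm (u a) (u b)))

border-diagonal-invertible : ∀ {n} {A : Mat n} → Symmetric A → Invertible A →
                             Invertible (border A (diagonal A) (even? n))
border-diagonal-invertible A-sym (B , AB , BA) = D , C⊗D , D⊗C
  where open BorderInverse A-sym AB BA

-- Positions in lists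

module _ {A : Set} where

  at : List A → ℕ → Maybe A
  at []       _       = nothing
  at (y ∷ ys) zero    = just y
  at (y ∷ ys) (suc i) = at ys i

  at-lookup : ∀ xs (i : Fin (length xs)) → at xs (toℕ i) ≡ just (lookup xs i)
  at-lookup (y ∷ ys) Fin.zero    = refl
  at-lookup (y ∷ ys) (Fin.suc i) = at-lookup ys i

  at⇒lookup : ∀ xs i {a} → at xs i ≡ just a → Σ (Fin (length xs)) λ f → toℕ f ≡ i × lookup xs f ≡ a
  at⇒lookup (y ∷ ys) zero    refl = Fin.zero , refl , refl
  at⇒lookup (y ∷ ys) (suc i) eq with at⇒lookup ys i eq
  ... | f , refl , lookup≡a = Fin.suc f , refl , lookup≡a

  at⇒∈ : ∀ xs i {a} → at xs i ≡ just a → a ∈ xs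
  at⇒∈ (y ∷ ys) zero    refl = here refl
  at⇒∈ (y ∷ ys) (suc i) eq   = there (at⇒∈ ys i eq)

  ∈⇒at : ∀ xs {a} → a ∈ xs → ∃ λ i → at xs i ≡ just a
  ∈⇒at (y ∷ ys) (here refl) = zero , refl
  ∈⇒at (y ∷ ys) (there a∈)  with ∈⇒at ys a∈
  ... | i , eq = suc i , eq

  at⇒< : ∀ xs i {a} → at xs i ≡ just a → i < length xs
  at⇒< (y ∷ ys) zero    eq = s≤s z≤n
  at⇒< (y ∷ ys) (suc i) eq = s≤s (at⇒< ys i eq)

  at-++ˡ : ∀ xs ys i → i < length xs → at (xs ++ ys) i ≡ at xs i
  at-++ˡ (x ∷ xs) ys zero    i<n       = refl
  at-++ˡ (x ∷ xs) ys (suc i) (s≤s i<n) = at-++ˡ xs ys i i<n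

  at-∷ʳ-length : ∀ xs y → at (xs ∷ʳ y) (length xs) ≡ just y
  at-∷ʳ-length []       y = refl
  at-∷ʳ-length (x ∷ xs) y = at-∷ʳ-length xs y

  at-∷ʳ⁻ : ∀ xs y i {a} → at (xs ∷ʳ y) i ≡ just a →
           (i < length xs × at xs i ≡ just a) ⊎ (i ≡ length xs × a ≡ y)
  at-∷ʳ⁻ []       y zero    refl = inj₂ (refl , refl)
  at-∷ʳ⁻ (x ∷ xs) y zero    eq   = inj₁ (s≤s z≤n , eq)
  at-∷ʳ⁻ (x ∷ xs) y (suc i) eq   with at-∷ʳ⁻ xs y i eq
  ... | inj₁ (i<n , eq′) = inj₁ (s≤s i<n , eq′)
  ... | inj₂ (refl , eq′) = inj₂ (refl , eq′)

  take-++ˡ : ∀ (xs ys : List A) i → i ≤ length xs → take i (xs ++ ys) ≡ take i xs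
  take-++ˡ xs       ys zero    _         = refl
  take-++ˡ (x ∷ xs) ys (suc i) (s≤s i≤n) = cong (x ∷_) (take-++ˡ xs ys i i≤n)

  length-∷ʳ : ∀ xs (y : A) → length (xs ∷ʳ y) ≡ suc (length xs)
  length-∷ʳ xs y = trans (length-++ xs) (+-comm (length xs) 1)

lookup-∷ʳ : ∀ {A : Set} (xs : List A) y (i : Fin (length (xs ∷ʳ y))) →
            lookup (xs ∷ʳ y) i ≡ maybe (lookup xs) y (unlast (cast (length-∷ʳ xs y) i))
lookup-∷ʳ []       y Fin.zero    = refl
lookup-∷ʳ (x ∷ xs) y Fin.zero    = refl
lookup-∷ʳ (x ∷ xs) y (Fin.suc i) with unlast (cast (length-∷ʳ xs y) i) | lookup-∷ʳ xs y i
... | just a  | eq = eq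
... | nothing | eq = eq

-- Pressing sequences

infix 4 _≅_

record _≅_ (K K′ : SPG) : Set where
  constructor mk≅
  field edges : ∀ a b → E K a b ≡ E K′ a b
open _≅_ public

≅-refl : ∀ {K} → K ≅ K
≅-refl = mk≅ λ a b → refl

≅-sym : ∀ {K K′} → K ≅ K′ → K′ ≅ K
≅-sym K≅K′ = mk≅ λ a b → sym (edges K≅K′ a b)

≅-trans : ∀ {K K′ K″} → K ≅ K′ → K′ ≅ K″ → K ≅ K″
≅-trans K≅K′ K′≅K″ = mk≅ λ a b → trans (edges K≅K′ a b) (edges K′≅K″ a b)

press-cong : ∀ {K K′} → K ≅ K′ → ∀ v → press K v ≅ press K′ v
press-cong (mk≅ e) v = mk≅ λ a b → cong₂ _xor_ (e a b) (cong₂ _∧_ (e v a) (e v b))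

pressSeq-cong : ∀ {K K′} ρ → K ≅ K′ → pressSeq K ρ ≅ pressSeq K′ ρ
pressSeq-cong []      K≅K′ = K≅K′
pressSeq-cong (v ∷ ρ) K≅K′ = pressSeq-cong ρ (press-cong K≅K′ v)

successful-cong : ∀ {K K′} τ → K ≅ K′ → Successful K τ → Successful K′ τ
successful-cong []      (mk≅ e) empty a b       = trans (sym (e a b)) (empty a b)
successful-cong (v ∷ τ) K≅K′    (looped , rest) =
  trans (sym (edges K≅K′ v v)) looped , successful-cong τ (press-cong K≅K′ v) rest

Legal : SPG → List ℕ → Set
Legal K []       = ⊤
Legal K (v ∷ vs) = E K v v ≡ true × Legal (press K v) vs

legal-take : ∀ K τ i → Successful K τ → Legal K (take i τ)
legal-take K []      zero    _               = tt
legal-take K []      (suc i) _               = tt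
legal-take K (v ∷ τ) zero    _               = tt
legal-take K (v ∷ τ) (suc i) (looped , rest) = looped , legal-take (press K v) τ i rest

successful-looped : ∀ K τ i {v} → Successful K τ → at τ i ≡ just v →
                    E (pressSeq K (take i τ)) v v ≡ true
successful-looped K (w ∷ τ) zero    (looped , _)    refl = looped
successful-looped K (w ∷ τ) (suc i) (_      , rest) eq   = successful-looped (press K w) τ i rest eq

Supported : List ℕ → SPG → Set
Supported S K = ∀ a b → E K a b ≡ true → a ∈ S × b ∈ S

press-supported : ∀ {S K} v → Supported S K → Supported S (press K v)
press-supported {K = K} v supp a b e with E K a b in eab | E K v a in eva | E K v b in evb
... | true  | _    | _    = supp a b eab
... | false | true | true = proj₂ (supp v a eva) , proj₂ (supp v b evb)

Isolated : ℕ → SPG → Set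
Isolated x K = ∀ b → E K x b ≡ false × E K b x ≡ false

supported-isolated : ∀ {S K x} → Supported S K → x ∉ S → Isolated x K
supported-isolated {K = K} {x} supp x∉S b with E K x b in exb | E K b x in ebx
... | false | false = refl , refl
... | true  | _     = ⊥-elim (x∉S (proj₁ (supp x b exb)))
... | false | true  = ⊥-elim (x∉S (proj₂ (supp b x ebx)))

press-isolated : ∀ {x K} v → Isolated x K → Isolated x (press K v)
press-isolated {x} {K} v iso b
  rewrite proj₁ (iso b) | proj₂ (iso b) | proj₂ (iso v) | ∧-zeroʳ (E K v b) = refl , refl

looped-≢-isolated : ∀ {x K v} → Isolated x K → E K v v ≡ true → v ≢ x
looped-≢-isolated iso looped refl with trans (sym looped) (proj₁ (iso _))
... | ()

-- The effect of pressing a vertex whose neighbourhood is exactly the set of looped vertices.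
pressLoops : SPG → SPG
pressLoops K = mkSPG (V K) λ a b → E K a b xor (E K a a ∧ E K b b)

pressLoops-loopless : ∀ K a → E (pressLoops K) a a ≡ false
pressLoops-loopless K a = trans (cong (E K a a xor_) (∧-idem (E K a a))) (xor-same (E K a a))

pressLoops-empty : ∀ {K} → Successful K [] → Successful (pressLoops K) []
pressLoops-empty {K} empty a b rewrite empty a b | empty a a = refl

press-rank-one : ∀ {K a} → Successful (pressLoops K) [] → E K a a ≡ true → press K a ≅ pressLoops K
press-rank-one {K} {a} empty looped = mk≅ λ c d → cong (E K c d xor_)
  (trans (cong₂ _∧_ (rank-one a c) (rank-one a d))
         (cong (λ l → (l ∧ E K c c) ∧ (l ∧ E K d d)) looped))
  where
  rank-one : ∀ c d → E K c d ≡ E K c c ∧ E K d d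
  rank-one c d = xor≡false⇒≡ (empty c d)

loopless-pressLoops : ∀ {K} → (∀ a → E K a a ≡ false) → pressLoops K ≅ K
loopless-pressLoops {K} loopless = mk≅ λ a b →
  trans (cong (λ l → E K a b xor (l ∧ E K b b)) (loopless a)) (xor-identityʳ (E K a b))

pressLoops-isolated : ∀ {x K} → Isolated x K → Isolated x (pressLoops K)
pressLoops-isolated {x} {K} iso b
  rewrite proj₁ (iso b) | proj₂ (iso b) | proj₁ (iso x) | ∧-zeroʳ (E K b b) = refl , refl

-- Cones and their successful pressing sequences

≡ᵇ-refl : ∀ x → (x ≡ᵇ x) ≡ true
≡ᵇ-refl x = dec-true (x ℕ.≟ x) refl

≢⇒≡ᵇ-false : ∀ {a x} → a ≢ x → (a ≡ᵇ x) ≡ false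
≢⇒≡ᵇ-false {a} {x} a≢x = dec-false (a ℕ.≟ x) a≢x

module Cone (x : ℕ) where

  cone : SPG → Bool → SPG
  cone K β = mkSPG (V K ∷ʳ x) λ a b →
    if a ≡ᵇ x then (if b ≡ᵇ x then β else E K b b)
              else (if b ≡ᵇ x then E K a a else E K a b)

  module _ (K : SPG) (β : Bool) where

    cone-apart : ∀ {a b} → a ≢ x → b ≢ x → E (cone K β) a b ≡ E K a b
    cone-apart a≢x b≢x rewrite ≢⇒≡ᵇ-false a≢x | ≢⇒≡ᵇ-false b≢x = refl

    cone-apexˡ : ∀ {b} → b ≢ x → E (cone K β) x b ≡ E K b b
    cone-apexˡ b≢x rewrite ≡ᵇ-refl x | ≢⇒≡ᵇ-false b≢x = refl

    cone-apexʳ : ∀ {a} → a ≢ x → E (cone K β) a x ≡ E K a a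
    cone-apexʳ a≢x rewrite ≡ᵇ-refl x | ≢⇒≡ᵇ-false a≢x = refl

    cone-apex : E (cone K β) x x ≡ β
    cone-apex rewrite ≡ᵇ-refl x = refl

  press-cone : ∀ K β {v} → v ≢ x → E K v v ≡ true → press (cone K β) v ≅ cone (press K v) (not β)
  press-cone K β {v} v≢x looped = mk≅ entries
    where
    vx : E (cone K β) v x ≡ true
    vx = trans (cone-apexʳ K β v≢x) looped
    entries : ∀ a b → E (press (cone K β) v) a b ≡ E (cone (press K v) (not β)) a b
    entries a b with a ℕ.≟ x | b ℕ.≟ x
    ... | yes refl | yes refl
      rewrite cone-apex K β | vx | cone-apex (press K v) (not β) = xor-true β
      where
      xor-true : ∀ β → β xor true ≡ not β
      xor-true true  = refl
      xor-true false = refl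
    ... | yes refl | no b≢x
      rewrite cone-apexˡ K β b≢x | vx | cone-apart K β v≢x b≢x | cone-apexˡ (press K v) (not β) b≢x
      = cong (E K b b xor_) (sym (∧-idem (E K v b)))
    ... | no a≢x | yes refl
      rewrite cone-apexʳ K β a≢x | vx | cone-apart K β v≢x a≢x | cone-apexʳ (press K v) (not β) a≢x
      = cong (E K a a xor_) (trans (∧-identityʳ (E K v a)) (sym (∧-idem (E K v a))))
    ... | no a≢x | no b≢x
      rewrite cone-apart K β a≢x b≢x | cone-apart K β v≢x a≢x | cone-apart K β v≢x b≢x
            | cone-apart (press K v) (not β) a≢x b≢x
      = refl

  press-apex : ∀ K → press (cone K true) x ≅ cone (pressLoops K) false
  press-apex K = mk≅ entries
    where
    entries : ∀ a b → E (press (cone K true) x) a b ≡ E (cone (pressLoops K) false) a b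
    entries a b with a ℕ.≟ x | b ℕ.≟ x
    ... | yes refl | yes refl rewrite cone-apex K true | cone-apex (pressLoops K) false = refl
    ... | yes refl | no b≢x
      rewrite cone-apexˡ K true b≢x | cone-apex K true | cone-apexˡ (pressLoops K) false b≢x
      = trans (xor-same (E K b b)) (sym (pressLoops-loopless K b))
    ... | no a≢x | yes refl
      rewrite cone-apexʳ K true a≢x | cone-apexˡ K true a≢x | cone-apex K true
            | cone-apexʳ (pressLoops K) false a≢x
      = trans (cong (E K a a xor_) (∧-identityʳ (E K a a)))
              (trans (xor-same (E K a a)) (sym (pressLoops-loopless K a)))
    ... | no a≢x | no b≢x
      rewrite cone-apart K true a≢x b≢x | cone-apexˡ K true a≢x | cone-apexˡ K true b≢x
            | cone-apart (pressLoops K) false a≢x b≢x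
      = refl

  cone-loopless : ∀ {K} → (∀ a → E K a a ≡ false) → ∀ a → E (cone K false) a a ≡ false
  cone-loopless {K} loopless a with a ℕ.≟ x
  ... | yes refl = cone-apex K false
  ... | no a≢x   = trans (cone-apart K false a≢x a≢x) (loopless a)

  cone-empty⁺ : ∀ {K} → Successful K [] → Successful (cone K false) []
  cone-empty⁺ {K} empty a b with a ℕ.≟ x | b ℕ.≟ x
  ... | yes refl | yes refl = cone-apex K false
  ... | yes refl | no b≢x   = trans (cone-apexˡ K false b≢x) (empty b b)
  ... | no a≢x   | yes refl = trans (cone-apexʳ K false a≢x) (empty a a)
  ... | no a≢x   | no b≢x   = trans (cone-apart K false a≢x b≢x) (empty a b)

  cone-empty⁻ : ∀ {K β} → Isolated x K → Successful (cone K β) [] → β ≡ false × Successful K []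
  cone-empty⁻ {K} {β} iso empty = trans (sym (cone-apex K β)) (empty x x) , K-empty
    where
    K-empty : Successful K []
    K-empty a b with a ℕ.≟ x | b ℕ.≟ x
    ... | yes refl | _        = proj₁ (iso b)
    ... | no _     | yes refl = proj₂ (iso a)
    ... | no a≢x   | no b≢x   = trans (sym (cone-apart K β a≢x b≢x)) (empty a b)

  cone-successful⁺ : ∀ {K} τ → Isolated x K → Successful K τ →
                     Successful (cone K (even? (length τ))) (τ ∷ʳ x)
  cone-successful⁺ {K} [] iso empty =
    cone-apex K true ,
    successful-cong [] (≅-sym (press-apex K))
      (cone-empty⁺ {pressLoops K} (pressLoops-empty {K} empty))
  cone-successful⁺ {K} (v ∷ τ) iso (looped , rest) =
    trans (cone-apart K β v≢x v≢x) looped ,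
    successful-cong (τ ∷ʳ x) (≅-sym (press-cone K β v≢x looped))
      (subst (λ β′ → Successful (cone (press K v) β′) (τ ∷ʳ x)) (sym not-β)
             (cone-successful⁺ τ (press-isolated {K = K} v iso) rest))
    where
    β = even? (suc (length τ))
    v≢x = looped-≢-isolated {K = K} iso looped
    not-β : not β ≡ even? (length τ)
    not-β = trans (cong not (even?-suc (length τ))) (not-involutive _)

  module _ {S : List ℕ} (x∉S : x ∉ S) where

    -- K + l lᵀ is empty iff K = l lᵀ, and then K is empty or emptied by one looped vertex,
    -- a sequence of odd length.
    cone-successful-apex : ∀ {K} σ → Supported S K →
                           (∀ τ → Successful K τ → even? (length τ) ≡ true) →
                           Successful (press (cone K true) x) σ → σ ≡ [] × Successful K []
    cone-successful-apex {K} (w ∷ σ) supp parity (looped , _)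
      with trans (sym looped) (trans (edges (press-apex K) w w)
                                     (cone-loopless {pressLoops K} (pressLoops-loopless K) w))
    ... | ()
    cone-successful-apex {K} [] supp parity empty = refl , K-empty
      where
      iso = supported-isolated {K = K} supp x∉S
      reduced-empty : Successful (pressLoops K) []
      reduced-empty = proj₂ (cone-empty⁻ {pressLoops K} (pressLoops-isolated {K = K} iso)
                                         (successful-cong [] (press-apex K) empty))
      K-empty : Successful K []
      K-empty with any? (λ a → E K a a ≟ true) S
      ... | yes some-looped with satisfied some-looped
      ...   | a , looped
        with parity (a ∷ [])
               (looped , successful-cong [] (≅-sym (press-rank-one {K} reduced-empty looped))
                                            reduced-empty)
      ...     | ()
      K-empty | no none = successful-cong [] (loopless-pressLoops {K} loopless) reduced-empty
        where
        loopless : ∀ a → E K a a ≡ false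
        loopless a with E K a a in looped
        ... | false = refl
        ... | true  = ⊥-elim (none (lose (proj₁ (supp a a looped)) looped))

    cone-successful⁻ : ∀ {K β} σ → Supported S K →
                       (∀ τ → Successful K τ → even? (length τ) ≡ β) →
                       Successful (cone K β) σ → ∃ λ τ → σ ≡ τ ∷ʳ x × Successful K τ
    cone-successful⁻ {K} {β} [] supp parity empty
      with cone-empty⁻ {K} (supported-isolated {K = K} supp x∉S) empty
    ... | refl , K-empty with parity [] K-empty
    ...   | ()
    cone-successful⁻ {K} {β} (v ∷ σ) supp parity (looped , rest) with v ℕ.≟ x
    ... | yes refl with trans (sym (cone-apex K β)) looped
    ...   | refl with cone-successful-apex σ supp parity rest
    ...     | refl , K-empty = [] , refl , K-empty
    cone-successful⁻ {K} {β} (v ∷ σ) supp parity (looped , rest) | no v≢x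
      with cone-successful⁻ σ (press-supported {K = K} v supp) parity′
             (successful-cong σ (press-cone K β v≢x looped′) rest)
      where
      looped′ : E K v v ≡ true
      looped′ = trans (sym (cone-apart K β v≢x v≢x)) looped
      parity′ : ∀ τ → Successful (press K v) τ → even? (length τ) ≡ not β
      parity′ τ s =
        trans (sym (not-involutive _))
              (cong not (trans (sym (even?-suc (length τ))) (parity (v ∷ τ) (looped′ , s))))
    ... | τ , refl , s = v ∷ τ , refl , (trans (sym (cone-apart K β v≢x v≢x)) looped , s)

  pressSeq-cone : ∀ {K} β ρ → Isolated x K → Legal K ρ →
                  ∃ λ β′ → pressSeq (cone K β) ρ ≅ cone (pressSeq K ρ) β′
  pressSeq-cone β []      iso _ = β , ≅-refl
  pressSeq-cone {K} β (v ∷ ρ) iso (looped , legal)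
    with pressSeq-cone (not β) ρ (press-isolated {K = K} v iso) legal
  ... | β′ , cone≅ =
    β′ , ≅-trans (pressSeq-cong ρ (press-cone K β (looped-≢-isolated {K = K} iso looped) looped))
                 cone≅

-- The poset of a cone

ArcAt : SPG → ℕ → ℕ → Set
ArcAt K a b = Σ ℕ λ i → Σ ℕ λ j → i ≤ j × at (V K) i ≡ just a × at (V K) j ≡ just b ×
  E (pressSeq K (take i (V K))) a b ≡ true

arc⇒arcAt : ∀ {K a b} → Arc K a b → ArcAt K a b
arc⇒arcAt {K} (i , j , i≤j , refl , refl , e) =
  toℕ i , toℕ j , i≤j , at-lookup (V K) i , at-lookup (V K) j , e

arcAt⇒arc : ∀ {K a b} → ArcAt K a b → Arc K a b
arcAt⇒arc {K} (i , j , i≤j , ai , bj , e) with at⇒lookup (V K) i ai | at⇒lookup (V K) j bj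
... | fi , refl , la | fj , refl , lb = fi , fj , i≤j , la , lb , e

-- LinExt with positions given as natural numbers.
Descending : SPG → List ℕ → Set
Descending K τ = ∀ i j {a b} → at τ i ≡ just a → at τ j ≡ just b → a ≻[ K ] b → i < j

linExt⇒descending : ∀ {K τ} → LinExt K τ → Descending K τ
linExt⇒descending {K} {τ} (_ , order) i j ai bj a≻b
  with at⇒lookup τ i ai | at⇒lookup τ j bj
... | fi , refl , refl | fj , refl , refl = order fi fj a≻b

descending⇒linExt : ∀ {K τ} → τ ↭ V K → Descending K τ → LinExt K τ
descending⇒linExt {K} {τ} τ↭V desc =
  τ↭V , λ i j a≻b → desc (toℕ i) (toℕ j) (at-lookup τ i) (at-lookup τ j) a≻b

module _ {W : List ℕ} {F F′ : ℕ → ℕ → Bool} (F≅F′ : mkSPG W F ≅ mkSPG W F′) where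

  private
    K = mkSPG W F
    K′ = mkSPG W F′

  arc-resp : ∀ {a b} → Arc K a b → Arc K′ a b
  arc-resp (i , j , i≤j , ai , bj , e) =
    i , j , i≤j , ai , bj , trans (sym (edges (pressSeq-cong (take (toℕ i) W) F≅F′) _ _)) e

  path-resp : ∀ {a b} → Path K a b → Path K′ a b
  path-resp here           = here
  path-resp (there arc p) = there (arc-resp arc) (path-resp p)

  linExt-resp : ∀ {τ} → LinExt K′ τ → LinExt K τ
  linExt-resp (τ↭W , order) = τ↭W , λ i j (p , a≢b) → order i j (path-resp p , a≢b)

autonomous-resp : ∀ {K K′} → V K ≡ V K′ → K ≅ K′ → Autonomous K → Autonomous K′
autonomous-resp {mkSPG W F} {mkSPG .W F′} refl K≅K′ (fullRank , sorted , Σ≡LinExt) =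
    invertible-cong (λ i j → sym (edges K≅K′ _ _)) fullRank
  , successful-cong W K≅K′ sorted
  , λ τ → (λ s → linExt-resp (≅-sym K≅K′) (proj₁ (Σ≡LinExt τ) (successful-cong τ (≅-sym K≅K′) s)))
        , (λ ext → successful-cong τ K≅K′ (proj₂ (Σ≡LinExt τ) (linExt-resp K≅K′ ext)))

module ConeOrder {G : SPG} {x : ℕ} (x∉V : x ∉ V G) (iso : Isolated x G)
                 (sorted : Successful G (V G)) (β : Bool) where

  open Cone x

  private
    H = cone G β
    n = length (V G)

  ∈⇒≢apex : ∀ {a} → a ∈ V G → a ≢ x
  ∈⇒≢apex a∈V refl = x∉V a∈V

  prefix-cone : ∀ i → i ≤ n →
                ∃ λ β′ → pressSeq H (take i (V H)) ≅ cone (pressSeq G (take i (V G))) β′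
  prefix-cone i i≤n rewrite take-++ˡ (V G) [ x ] i i≤n =
    pressSeq-cone β (take i (V G)) iso (legal-take G (V G) i sorted)

  prefix-apart : ∀ i {a b} → i ≤ n → a ∈ V G → b ∈ V G →
                 E (pressSeq H (take i (V H))) a b ≡ E (pressSeq G (take i (V G))) a b
  prefix-apart i i≤n a∈V b∈V with prefix-cone i i≤n
  ... | β′ , cone≅ =
    trans (edges cone≅ _ _) (cone-apart (pressSeq G (take i (V G))) β′ (∈⇒≢apex a∈V) (∈⇒≢apex b∈V))

  arc-cone⁻ : ∀ {a b} → ArcAt H a b → b ≡ x ⊎ ArcAt G a b
  arc-cone⁻ (i , j , i≤j , ai , bj , e) with at-∷ʳ⁻ (V G) x j bj
  ... | inj₂ (_ , b≡x)    = inj₁ b≡x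
  ... | inj₁ (j<n , bj′) = inj₂ (i , j , i≤j , ai′ , bj′ ,
          trans (sym (prefix-apart i (<⇒≤ i<n) (at⇒∈ (V G) i ai′) (at⇒∈ (V G) j bj′))) e)
    where
    i<n = ≤-<-trans i≤j j<n
    ai′ = trans (sym (at-++ˡ (V G) [ x ] i i<n)) ai

  arc-cone⁺ : ∀ {a b} → ArcAt G a b → ArcAt H a b
  arc-cone⁺ (i , j , i≤j , ai , bj , e) =
    i , j , i≤j , trans (at-++ˡ (V G) [ x ] i i<n) ai ,
    trans (at-++ˡ (V G) [ x ] j (at⇒< (V G) j bj)) bj ,
    trans (prefix-apart i (<⇒≤ i<n) (at⇒∈ (V G) i ai) (at⇒∈ (V G) j bj)) e
    where
    i<n = at⇒< (V G) i ai

  -- Every vertex of G is looped when it is pressed, hence adjacent to the apex at that moment.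
  arc-to-apex : ∀ i {a} → at (V G) i ≡ just a → ArcAt H a x
  arc-to-apex i {a} ai with prefix-cone i (<⇒≤ (at⇒< (V G) i ai))
  ... | β′ , cone≅ =
    i , n , <⇒≤ i<n , trans (at-++ˡ (V G) [ x ] i i<n) ai , at-∷ʳ-length (V G) x ,
    trans (edges cone≅ a x)
          (trans (cone-apexʳ (pressSeq G (take i (V G))) β′ (∈⇒≢apex (at⇒∈ (V G) i ai)))
                 (successful-looped G (V G) i sorted ai))
    where
    i<n = at⇒< (V G) i ai

  path-from-apex : ∀ {b} → Path G x b → b ≡ x
  path-from-apex here          = refl
  path-from-apex (there arc _) with arc⇒arcAt arc
  ... | i , _ , _ , ai , _ = ⊥-elim (x∉V (at⇒∈ (V G) i ai))

  path-cone⁻ : ∀ {a b} → Path H a b → b ≡ x ⊎ Path G a b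
  path-cone⁻ here = inj₂ here
  path-cone⁻ (there arc p) with path-cone⁻ p | arc-cone⁻ (arc⇒arcAt arc)
  ... | inj₁ b≡x | _          = inj₁ b≡x
  ... | inj₂ q   | inj₁ refl  = inj₁ (path-from-apex q)
  ... | inj₂ q   | inj₂ arc′  = inj₂ (there (arcAt⇒arc arc′) q)

  path-cone⁺ : ∀ {a b} → Path G a b → Path H a b
  path-cone⁺ here          = here
  path-cone⁺ (there arc p) = there (arcAt⇒arc (arc-cone⁺ (arc⇒arcAt arc))) (path-cone⁺ p)

  linExt-cone⁺ : ∀ {τ} → LinExt G τ → LinExt H (τ ∷ʳ x)
  linExt-cone⁺ {τ} ext@(τ↭V , _) = descending⇒linExt (++⁺ʳ [ x ] τ↭V) descending
    where
    apex∉τ : ∀ j {b} → at τ j ≡ just b → b ≢ x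
    apex∉τ j bj refl = x∉V (∈-resp-↭ τ↭V (at⇒∈ τ j bj))
    descending : Descending H (τ ∷ʳ x)
    descending i j ai bj (p , a≢b) with at-∷ʳ⁻ τ x j bj
    ... | inj₂ (refl , refl) with at-∷ʳ⁻ τ x i ai
    ...   | inj₁ (i<n , _)  = i<n
    ...   | inj₂ (_ , refl) = ⊥-elim (a≢b refl)
    descending i j ai bj (p , a≢b) | inj₁ (_ , bj′) with path-cone⁻ p
    ... | inj₁ b≡x = ⊥-elim (apex∉τ j bj′ b≡x)
    ... | inj₂ q with at-∷ʳ⁻ τ x i ai
    ...   | inj₁ (_ , ai′) = linExt⇒descending ext i j ai′ bj′ (q , a≢b)
    ...   | inj₂ (_ , refl) = ⊥-elim (apex∉τ j bj′ (path-from-apex q))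

  -- The apex must come last: every other vertex lies above it.
  linExt-cone⁻ : ∀ {σ} → LinExt H σ → ∃ λ τ → σ ≡ τ ∷ʳ x × LinExt G τ
  linExt-cone⁻ {σ} ext@(σ↭ , _) with reverseView σ
  ... | [] with trans (↭-length σ↭) (length-∷ʳ (V G) x)
  ...   | ()
  linExt-cone⁻ {σ} ext@(σ↭ , _) | τ ∶ _ ∶ʳ c with c ℕ.≟ x
  ... | yes refl = τ , refl , descending⇒linExt τ↭V descending
    where
    τ↭V : τ ↭ V G
    τ↭V = subst₂ _↭_ (++-identityʳ τ) (++-identityʳ (V G)) (drop-mid τ (V G) σ↭)
    descending : Descending G τ
    descending i j ai bj (p , a≢b) =
      linExt⇒descending ext i j (trans (at-++ˡ τ [ x ] i (at⇒< τ i ai)) ai)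
                                (trans (at-++ˡ τ [ x ] j (at⇒< τ j bj)) bj) (path-cone⁺ p , a≢b)
  ... | no c≢x = ⊥-elim (<-irrefl refl (<-≤-trans last<p p≤last))
    where
    c∈V : c ∈ V G
    c∈V with ∈-++⁻ (V G) (∈-resp-↭ σ↭ (∈-++⁺ʳ τ (here refl)))
    ... | inj₁ c∈V       = c∈V
    ... | inj₂ (here c≡x) = ⊥-elim (c≢x c≡x)
    apex-position = ∈⇒at (τ ∷ʳ c) (∈-resp-↭ (↭-sym σ↭) (∈-++⁺ʳ (V G) (here refl)))
    p = proj₁ apex-position
    c-position = ∈⇒at (V G) c∈V
    last<p : length τ < p
    last<p = linExt⇒descending ext (length τ) p (at-∷ʳ-length τ c) (proj₂ apex-position)
      (there (arcAt⇒arc (arc-to-apex (proj₁ c-position) (proj₂ c-position))) here , c≢x)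
    p≤last : p ≤ length τ
    p≤last = ≤-pred (subst (p <_) (length-∷ʳ τ c) (at⇒< (τ ∷ʳ c) p (proj₂ apex-position)))

-- G ⊕ x

module ConeRank {G : SPG} {x : ℕ} (x∉V : x ∉ V G) (symmetric : ∀ u w → E G u w ≡ E G w u) where

  open Cone x

  private
    n = length (V G)
    A = adjacency G

  cone-fullRank : FullRank G → FullRank (cone G (even? n))
  cone-fullRank fullRank =
    invertible-cast (length-∷ʳ (V G) x) {C = border A (diagonal A) (even? n)} entries
      (border-diagonal-invertible (λ i j → symmetric (lookup (V G) i) (lookup (V G) j)) fullRank)
    where
    β = even? n
    lookup≢apex : ∀ a → lookup (V G) a ≢ x
    lookup≢apex a refl = x∉V (∈-lookup a)
    entries : ∀ i j → adjacency (cone G β) i j ≡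
              borderEntry A (diagonal A) β (unlast (cast (length-∷ʳ (V G) x) i))
                                           (unlast (cast (length-∷ʳ (V G) x) j))
    entries i j rewrite lookup-∷ʳ (V G) x i | lookup-∷ʳ (V G) x j
      with unlast (cast (length-∷ʳ (V G) x) i) | unlast (cast (length-∷ʳ (V G) x) j)
    ... | just a  | just b  = cone-apart G β (lookup≢apex a) (lookup≢apex b)
    ... | just a  | nothing = cone-apexʳ G β (lookup≢apex a)
    ... | nothing | just b  = cone-apexˡ G β (lookup≢apex b)
    ... | nothing | nothing = cone-apex G β

insert-∷ʳ : ∀ {x} ys → All (_< x) ys → insert x ys ≡ ys ∷ʳ x
insert-∷ʳ     []       []            = refl
insert-∷ʳ {x} (y ∷ ys) (y<x ∷ below) with x <ᵇ y in x<ᵇy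
... | true  = ⊥-elim (<-asym y<x (<ᵇ⇒< x y (subst T (sym x<ᵇy) tt)))
... | false = cong (y ∷_) (insert-∷ʳ ys below)

⊕≅cone : ∀ G x → Isolated x G → G ⊕ x ≅ Cone.cone x G (even? (length (V G)))
⊕≅cone G x iso = mk≅ entries
  where
  open Cone x
  entries : ∀ a b → E (G ⊕ x) a b ≡ E (cone G (even? (length (V G)))) a b
  entries a b with a ℕ.≟ x | b ℕ.≟ x
  ... | yes refl | yes refl rewrite ≡ᵇ-refl x | proj₁ (iso x) = refl
  ... | yes refl | no b≢x
    rewrite ≡ᵇ-refl x | ≢⇒≡ᵇ-false b≢x | proj₁ (iso b) = ∨-identityʳ (E G b b)
  ... | no a≢x | yes refl
    rewrite ≡ᵇ-refl x | ≢⇒≡ᵇ-false a≢x | proj₂ (iso a) = ∨-identityʳ (E G a a)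
  ... | no a≢x | no b≢x
    rewrite ≢⇒≡ᵇ-false a≢x | ≢⇒≡ᵇ-false b≢x = ∨-identityʳ (E G a b)

module _ {G : SPG} (osp : IsOSP G) {x : ℕ} (below : All (_< x) (V G)) where

  open Cone x

  private
    n = length (V G)
    x∉V : x ∉ V G
    x∉V x∈V = <-irrefl refl (All.lookup below x∈V)
    iso : Isolated x G
    iso = supported-isolated {K = G} (IsOSP.supported osp) x∉V

  cone-autonomous : Autonomous G → Autonomous (cone G (even? n))
  cone-autonomous (fullRank , sorted , Σ≡LinExt) =
    ConeRank.cone-fullRank x∉V (IsOSP.symmetric osp) fullRank ,
    cone-successful⁺ (V G) iso sorted ,
    λ σ → sound σ , complete σ
    where
    open ConeOrder x∉V iso sorted (even? n)
    parity : ∀ τ → Successful G τ → even? (length τ) ≡ even? n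
    parity τ s = cong even? (↭-length (proj₁ (proj₁ (Σ≡LinExt τ) s)))
    sound : ∀ σ → Successful (cone G (even? n)) σ → LinExt (cone G (even? n)) σ
    sound σ s with cone-successful⁻ x∉V σ (IsOSP.supported osp) parity s
    ... | τ , refl , sτ = linExt-cone⁺ (proj₁ (Σ≡LinExt τ) sτ)
    complete : ∀ σ → LinExt (cone G (even? n)) σ → Successful (cone G (even? n)) σ
    complete σ ext with linExt-cone⁻ ext
    ... | τ , refl , extτ = subst (λ β → Successful (cone G β) (τ ∷ʳ x)) (parity τ sτ)
                                  (cone-successful⁺ τ iso sτ)
      where
      sτ = proj₂ (Σ≡LinExt τ) extτ

  ⊕-autonomous : Autonomous G → Autonomous (G ⊕ x)
  ⊕-autonomous aut = autonomous-resp (sym (insert-∷ʳ (V G) below)) (≅-sym (⊕≅cone G x iso))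
                                     (cone-autonomous aut)

mainTheorem4 : (G : SPG) → IsOSP G → Autonomous G →
    (x : ℕ) → 0 < x → All (λ v → v < x) (V G) →
    Autonomous (G ⊕ x)
-- Positivity of x only keeps G ⊕ x an OSP-graph, which autonomy does not require.
mainTheorem4 G osp aut x _ below = ⊕-autonomous osp below aut
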